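{- Let $N \geq \Delta \geq 2$ be integers. If $F$ is a forest without isolated vertices with $e(F)=N$, $\Delta(F)=\Delta$ and $e(L(F)) = g(N,\Delta)$, then $F$ is a tree.
   Context: All graphs are finite and simple; $L(G)$ is the line graph, so $e(L(G))=\sum_v\binom{\deg(v)}{2}$. For integers $N\ge\Delta\ge1$, $g(N,\Delta)=\max\{e(L(F)) : F \text{ acyclic},\ e(F)=N,\ \Delta(F)=\Delta,\ \delta(F)\geq 1\}$, where $\Delta(F)$ and $\delta(F)$ are the maximum and minimum degree. -}

module Defs where

open import Data.Nat using (ℕ; zero; suc; _+_; _≤_; _<ᵇ_)
open import Data.Nat.Combinatorics using (_C_)
open import Data.Bool using (Bool; true; false; if_then_else_; _∧_)
open import Data.Fin using (Fin; toℕ)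
open import Data.List using (List; []; _∷_; _++_; [_]; map; length; concatMap)
open import Data.Nat.ListAction using (sum)
open import Data.Unit using (⊤)
open import Data.List.Relation.Unary.Unique.Propositional using (Unique)
open import Data.List.Relation.Unary.All using (All)
open import Data.Product using (Σ; ∃; _×_; _,_)
open import Relation.Binary.PropositionalEquality using (_≡_)
open import Relation.Nullary using (¬_)
open import Data.List using (allFin)

record Graph (n : ℕ) : Set where
  field
    adj     : Fin n → Fin n → Bool
    sym     : ∀ i j → adj i j ≡ adj j i
    irrefl  : ∀ i → adj i i ≡ false
open Graph public

vertices : (n : ℕ) → List (Fin n)
vertices n = allFin n

deg : ∀ {n} → Graph n → Fin n → ℕ
deg {n} G v = sum (map (λ j → if adj G v j then 1 else 0) (vertices n))

numEdges : ∀ {n} → Graph n → ℕ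
numEdges {n} G =
  sum (concatMap (λ i → map (λ j → if adj G i j ∧ (toℕ i <ᵇ toℕ j) then 1 else 0)
                               (vertices n))
                 (vertices n))

-- e(L(G)) = Σ_v binom(deg v, 2)
lineEdges : ∀ {n} → Graph n → ℕ
lineEdges {n} G = sum (map (λ v → deg G v C 2) (vertices n))

MaxDegree : ∀ {n} → Graph n → ℕ → Set
MaxDegree {n} G D = (∀ v → deg G v ≤ D) × ∃ λ v → deg G v ≡ D

NoIsolated : ∀ {n} → Graph n → Set
NoIsolated G = ∀ v → 1 ≤ deg G v

Chain : ∀ {n} → Graph n → List (Fin n) → Set
Chain G []            = ⊤
Chain G (x ∷ [])      = ⊤
Chain G (x ∷ y ∷ xs)  = (adj G x y ≡ true) × Chain G (y ∷ xs)

HasCycle : ∀ {n} → Graph n → Set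
HasCycle G = Σ _ λ x → Σ _ λ vs →
  (2 ≤ length vs) × Unique (x ∷ vs) × Chain G (x ∷ vs ++ [ x ])

Acyclic : ∀ {n} → Graph n → Set
Acyclic G = ¬ HasCycle G

data Walk {n : ℕ} (G : Graph n) : Fin n → Fin n → Set where
  here : ∀ {u} → Walk G u u
  step : ∀ {u w v} → adj G u w ≡ true → Walk G w v → Walk G u v

Connected : ∀ {n} → Graph n → Set
Connected G = ∀ u v → Walk G u v

IsTree : ∀ {n} → Graph n → Set
IsTree {n} G = (1 ≤ n) × Connected G × Acyclic G

Admissible : ℕ → ℕ → ∀ {n} → Graph n → Set
Admissible N D G = Acyclic G × numEdges G ≡ N × MaxDegree G D × NoIsolated G

-- e(L(F)) = g(N,Δ) for an admissible F: F attains the maximum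
AttainsG : ℕ → ℕ → ∀ {n} → Graph n → Set
AttainsG N D F = ∀ m (F′ : Graph m) → Admissible N D F′ → lineEdges F′ ≤ lineEdges F

{-# OPTIONS --safe #-}
-- Suppose an optimal forest F had two components. Take a leaf a in one of them and a
-- leaf b, with neighbour c, in another; such leaves exist by the longest-path argument.
-- Deleting b and joining a to c gives a forest (the new edge links two components), with
-- the same number of edges and no isolated vertices. Every degree is unchanged except
-- that of a, which rises from 1 to 2 ≤ Δ; a vertex of degree Δ ≥ 2 is neither a nor b,
-- so the maximum degree is still Δ. But the contribution of a to e(L(F)) grows from
-- C(1,2) = 0 to C(2,2) = 1, contradicting the maximality of e(L(F)).
module Submission where

open import Defs hiding (sym)
open import Data.Bool using (Bool; true; false; if_then_else_; _∧_; _∨_)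
import Data.Bool.Properties as Bool
open import Data.Bool.Properties using (∨-identityʳ; ∨-comm; ∧-comm; ∧-zeroʳ)
open import Data.Empty using (⊥-elim)
open import Data.Fin using (Fin; zero; suc; toℕ; punchIn; punchOut)
open import Data.Fin.Properties
  using (_≟_; any?; pigeonhole; punchInᵢ≢i; punchIn-injective; punchIn-punchOut; toℕ-injective)
open import Data.List as List using (List; []; _∷_; _++_; [_]; length; allFin; concatMap; initLast; _∷ʳ′_)
open import Data.List.Membership.Propositional using (_∈_)
open import Data.List.Membership.Propositional.Properties using (∈-∃++; ∈-lookup)
open import Data.List.Properties using (map-tabulate; length-map; map-++; ++-assoc; length-++)
open import Data.List.Relation.Unary.All as All using (All; []; _∷_)
open import Data.List.Relation.Unary.All.Properties using (¬Any⇒All¬; ++⁺; ++⁻ˡ; ++⁻ʳ)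
open import Data.List.Relation.Unary.AllPairs using ([]; _∷_)
open import Data.List.Relation.Unary.Any using (here; there)
open import Data.List.Relation.Unary.Unique.Propositional using (Unique)
import Data.List.Relation.Unary.Unique.Propositional.Properties as Unique
open import Data.Nat using (ℕ; zero; suc; _+_; _*_; _≤_; _<_; z≤n; s≤s; _<ᵇ_)
open import Data.Nat.Combinatorics using (_C_)
open import Data.Nat.ListAction using () renaming (sum to listSum)
open import Data.Nat.ListAction.Properties using (sum-++)
open import Data.Nat.Properties
  using ( +-0-commutativeMonoid; _≤?_; ≤-refl; ≤-reflexive; ≤-trans; <-≤-trans; <⇒≢; <⇒≱; ≰⇒>
        ; +-identityʳ; +-assoc; +-comm; +-suc; suc-injective; +-cancelʳ-≡; *-cancelˡ-≡
        ; +-mono-≤; +-monoʳ-≤; +-mono-<-≤; +-mono-≤-<; m≤m+n; m≤n+m; m<m+n )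
open import Algebra.Properties.CommutativeMonoid.Sum +-0-commutativeMonoid
  using (sum; sum-syntax; sum-cong-≗; sum-remove; sum-replicate-zero; ∑-distrib-+; ∑-comm)
open import Data.Product using (Σ; ∃; _×_; _,_; proj₁; proj₂)
open import Data.Sum using (_⊎_; inj₁; inj₂)
open import Function using (_∘_; id; case_of_)
open import Relation.Binary.PropositionalEquality hiding ([_])
open import Relation.Nullary using (¬_; does; yes; no)
open import Relation.Nullary.Decidable using (dec-true; dec-false; decidable-stable; _×-dec_; ¬?)

𝟙 : Bool → ℕ
𝟙 b = if b then 1 else 0

𝟙≤1 : ∀ b → 𝟙 b ≤ 1
𝟙≤1 true  = ≤-refl
𝟙≤1 false = z≤n

𝟙-∨-≤ : ∀ p q → 𝟙 p ≤ 𝟙 (p ∨ q)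
𝟙-∨-≤ true  q = ≤-refl
𝟙-∨-≤ false q = z≤n

𝟙-∨ : ∀ p q → (p ≡ true → q ≡ false) → 𝟙 (p ∨ q) ≡ 𝟙 p + 𝟙 q
𝟙-∨ true  q disjoint rewrite disjoint refl = refl
𝟙-∨ false q disjoint = refl

sum-map-allFin : ∀ n (f : Fin n → ℕ) → listSum (List.map f (allFin n)) ≡ ∑[ i < n ] f i
sum-map-allFin n f = trans (cong listSum (map-tabulate id f)) (sum-tabulate n)
  where
  sum-tabulate : ∀ n {f : Fin n → ℕ} → listSum (List.tabulate f) ≡ sum f
  sum-tabulate zero        = refl
  sum-tabulate (suc n) {f} = cong (f zero +_) (sum-tabulate n)

sum-concatMap : ∀ {A : Set} (g : A → List ℕ) xs →
                listSum (concatMap g xs) ≡ listSum (List.map (listSum ∘ g) xs)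
sum-concatMap g []       = refl
sum-concatMap g (x ∷ xs) = trans (sum-++ (g x) _) (cong (listSum (g x) +_) (sum-concatMap g xs))

sum-mono-≤ : ∀ {n} {f g : Fin n → ℕ} → (∀ i → f i ≤ g i) → sum f ≤ sum g
sum-mono-≤ {zero}  f≤g = z≤n
sum-mono-≤ {suc n} f≤g = +-mono-≤ (f≤g zero) (sum-mono-≤ (f≤g ∘ suc))

sum-mono-< : ∀ {n} {f g : Fin n → ℕ} → (∀ i → f i ≤ g i) → ∀ k → f k < g k → sum f < sum g
sum-mono-< f≤g zero    fk<gk = +-mono-<-≤ fk<gk (sum-mono-≤ (f≤g ∘ suc))
sum-mono-< f≤g (suc k) fk<gk = +-mono-≤-< (f≤g zero) (sum-mono-< (f≤g ∘ suc) k fk<gk)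

sum-zero : ∀ {n} {f : Fin n → ℕ} → (∀ i → f i ≡ 0) → sum f ≡ 0
sum-zero {n} f≡0 = trans (sum-cong-≗ f≡0) (sum-replicate-zero n)

sum-point : ∀ {n} (f : Fin (suc n) → ℕ) c → (∀ j → j ≢ c → f j ≡ 0) → sum f ≡ f c
sum-point f c vanish = begin
  sum f                        ≡⟨ sum-remove {i = c} f ⟩
  f c + sum (f ∘ punchIn c)    ≡⟨ cong (f c +_) (sum-zero (λ j → vanish _ (punchInᵢ≢i c j))) ⟩
  f c + 0                      ≡⟨ +-identityʳ (f c) ⟩
  f c                          ∎
  where open ≡-Reasoning

sum-𝟙≤ : ∀ {n} (R : Fin n → Bool) → ∑[ j < n ] 𝟙 (R j) ≤ n
sum-𝟙≤ {zero}  R = z≤n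
sum-𝟙≤ {suc n} R = +-mono-≤ (𝟙≤1 (R zero)) (sum-𝟙≤ (R ∘ suc))

_≡ᵇ_ : ∀ {n} → Fin n → Fin n → Bool
i ≡ᵇ j = does (i ≟ j)

≡ᵇ-refl : ∀ {n} (i : Fin n) → (i ≡ᵇ i) ≡ true
≡ᵇ-refl i = dec-true (i ≟ i) refl

≢⇒≡ᵇ-false : ∀ {n} {i j : Fin n} → i ≢ j → (i ≡ᵇ j) ≡ false
≢⇒≡ᵇ-false {i = i} {j} = dec-false (i ≟ j)

≡ᵇ⇒≡ : ∀ {n} {i j : Fin n} → (i ≡ᵇ j) ≡ true → i ≡ j
≡ᵇ⇒≡ {i = i} {j} e with i ≟ j
... | yes i≡j = i≡j

sum-𝟙-∧-≡ᵇ : ∀ {n} p (c : Fin n) → ∑[ j < n ] 𝟙 (p ∧ j ≡ᵇ c) ≡ 𝟙 p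
sum-𝟙-∧-≡ᵇ {suc n} false c = sum-zero {f = λ j → 𝟙 (false ∧ j ≡ᵇ c)} (λ _ → refl)
sum-𝟙-∧-≡ᵇ {suc n} true  c = trans (sum-point (λ j → 𝟙 (j ≡ᵇ c)) c (λ j j≢c → cong 𝟙 (≢⇒≡ᵇ-false j≢c)))
                                   (cong 𝟙 (≡ᵇ-refl c))

adj-sym : ∀ {n} (G : Graph n) {i j} → adj G i j ≡ true → adj G j i ≡ true
adj-sym G {i} {j} e = trans (Graph.sym G j i) e

adj⇒≢ : ∀ {n} (G : Graph n) {i j} → adj G i j ≡ true → i ≢ j
adj⇒≢ G {i} ij refl with trans (sym ij) (Graph.irrefl G i)
... | ()

deg-sum : ∀ {n} (G : Graph n) v → deg G v ≡ ∑[ j < n ] 𝟙 (adj G v j)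
deg-sum {n} G v = sum-map-allFin n _

lineEdges-sum : ∀ {n} (G : Graph n) → lineEdges G ≡ ∑[ v < n ] (deg G v C 2)
lineEdges-sum {n} G = sum-map-allFin n _

forward : ∀ {n} → Graph n → Fin n → Fin n → ℕ
forward G i j = 𝟙 (adj G i j ∧ (toℕ i <ᵇ toℕ j))

numEdges-sum : ∀ {n} (G : Graph n) → numEdges G ≡ ∑[ i < n ] ∑[ j < n ] forward G i j
numEdges-sum {n} G = begin
  numEdges G                               ≡⟨ sum-concatMap _ (allFin n) ⟩
  listSum (List.map row (allFin n))        ≡⟨ sum-map-allFin n row ⟩
  ∑[ i < n ] row i                         ≡⟨ sum-cong-≗ (λ i → sum-map-allFin n (forward G i)) ⟩
  ∑[ i < n ] ∑[ j < n ] forward G i j      ∎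
  where
  open ≡-Reasoning
  row : Fin n → ℕ
  row i = listSum (List.map (forward G i) (allFin n))

<ᵇ-exclusive : ∀ a b → a ≢ b → 𝟙 (a <ᵇ b) + 𝟙 (b <ᵇ a) ≡ 1
<ᵇ-exclusive zero    zero    a≢b = ⊥-elim (a≢b refl)
<ᵇ-exclusive zero    (suc b) a≢b = refl
<ᵇ-exclusive (suc a) zero    a≢b = refl
<ᵇ-exclusive (suc a) (suc b) a≢b = <ᵇ-exclusive a b (a≢b ∘ cong suc)

𝟙-adj-forward : ∀ {n} (G : Graph n) i j → 𝟙 (adj G i j) ≡ forward G i j + forward G j i
𝟙-adj-forward G i j rewrite Graph.sym G j i with adj G i j in ij
... | false = refl
... | true  = sym (<ᵇ-exclusive (toℕ i) (toℕ j) (adj⇒≢ G ij ∘ toℕ-injective))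

handshake : ∀ {n} (G : Graph n) → ∑[ v < n ] deg G v ≡ 2 * numEdges G
handshake {n} G = begin
  ∑[ i < n ] deg G i                                            ≡⟨ sum-cong-≗ (deg-sum G) ⟩
  ∑[ i < n ] ∑[ j < n ] 𝟙 (adj G i j)                            ≡⟨ sum-cong-≗ (λ i → sum-cong-≗ (𝟙-adj-forward G i)) ⟩
  ∑[ i < n ] ∑[ j < n ] (forward G i j + forward G j i)          ≡⟨ sum-cong-≗ (λ i → ∑-distrib-+ (forward G i) _) ⟩
  ∑[ i < n ] (∑[ j < n ] forward G i j + ∑[ j < n ] forward G j i) ≡⟨ ∑-distrib-+ (λ i → ∑[ j < n ] forward G i j) (λ i → ∑[ j < n ] forward G j i) ⟩
  e + ∑[ i < n ] ∑[ j < n ] forward G j i                        ≡⟨ cong (e +_) (∑-comm (λ i j → forward G j i)) ⟩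
  e + e                                                          ≡⟨ cong (e +_) (sym (+-identityʳ e)) ⟩
  2 * e                                                          ≡⟨ cong (2 *_) (sym (numEdges-sum G)) ⟩
  2 * numEdges G                                                 ∎
  where
  open ≡-Reasoning
  e : ℕ
  e = ∑[ i < n ] ∑[ j < n ] forward G i j

neighbour : ∀ {n} (G : Graph n) v → 1 ≤ deg G v → ∃ λ z → adj G v z ≡ true
neighbour {n} G v deg≥1 with any? (λ z → adj G v z Bool.≟ true)
... | yes found = found
... | no  none  = ⊥-elim (<⇒≢ (≤-trans deg≥1 (≤-reflexive (deg-sum G v))) (sym (sum-zero isolated)))
  where
  isolated : ∀ z → 𝟙 (adj G v z) ≡ 0
  isolated z with adj G v z in vz
  ... | true  = ⊥-elim (none (z , vz))
  ... | false = refl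

IsLeaf : ∀ {n} → Graph n → Fin n → Fin n → Set
IsLeaf G ℓ p = adj G ℓ p ≡ true × (∀ y → adj G ℓ y ≡ true → y ≡ p)

leaf-adj : ∀ {n} (G : Graph n) {ℓ p} → IsLeaf G ℓ p → ∀ x → adj G x ℓ ≡ x ≡ᵇ p
leaf-adj G {ℓ} {p} (ℓp , only-p) x with x ≟ p
... | yes refl = adj-sym G ℓp
... | no  x≢p with adj G x ℓ in xℓ
...   | true  = ⊥-elim (x≢p (only-p x (adj-sym G xℓ)))
...   | false = refl

deg-leaf : ∀ {n} (G : Graph n) {ℓ p} → IsLeaf G ℓ p → deg G ℓ ≡ 1
deg-leaf {suc n} G {ℓ} {p} (ℓp , only-p) = begin
  deg G ℓ                     ≡⟨ deg-sum G ℓ ⟩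
  ∑[ j < suc n ] 𝟙 (adj G ℓ j) ≡⟨ sum-point (λ j → 𝟙 (adj G ℓ j)) p others ⟩
  𝟙 (adj G ℓ p)               ≡⟨ cong 𝟙 ℓp ⟩
  1                           ∎
  where
  open ≡-Reasoning
  others : ∀ j → j ≢ p → 𝟙 (adj G ℓ j) ≡ 0
  others j j≢p with adj G ℓ j in ℓj
  ... | true  = ⊥-elim (j≢p (only-p j ℓj))
  ... | false = refl

-- Walks, cycles and the longest-path argument

module _ {n} {G : Graph n} where

  walk-snoc : ∀ {u w v} → Walk G u w → adj G w v ≡ true → Walk G u v
  walk-snoc here       wv = step wv here
  walk-snoc (step e p) wv = step e (walk-snoc p wv)

  chain⇒walk : ∀ x xs z → Chain G (x ∷ xs ++ [ z ]) → Walk G x z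
  chain⇒walk x []       z (xz , _) = step xz here
  chain⇒walk x (y ∷ xs) z (xy , c) = step xy (chain⇒walk y xs z c)

  chain-split : ∀ xs y ys → Chain G (xs ++ y ∷ ys) → Chain G (xs ++ [ y ]) × Chain G (y ∷ ys)
  chain-split []           y ys c       = _ , c
  chain-split (x ∷ [])     y ys (e , c) = (e , _) , c
  chain-split (x ∷ x′ ∷ xs) y ys (e , c) = let c₁ , c₂ = chain-split (x′ ∷ xs) y ys c in (e , c₁) , c₂

  chain-join : ∀ xs y ys → Chain G (xs ++ [ y ]) → Chain G (y ∷ ys) → Chain G (xs ++ y ∷ ys)
  chain-join []            y ys _        c₂ = c₂
  chain-join (x ∷ [])      y ys (e , _)  c₂ = e , c₂
  chain-join (x ∷ x′ ∷ xs) y ys (e , c₁) c₂ = e , chain-join (x′ ∷ xs) y ys c₁ c₂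

chain-map : ∀ {m n} {H : Graph m} {G : Graph n} (f : Fin m → Fin n) →
            (∀ {x y} → adj H x y ≡ true → adj G (f x) (f y) ≡ true) →
            ∀ xs → Chain H xs → Chain G (List.map f xs)
chain-map f hom []           _       = _
chain-map f hom (x ∷ [])     _       = _
chain-map f hom (x ∷ y ∷ xs) (e , c) = hom e , chain-map f hom (y ∷ xs) c

chain-restrict : ∀ {n} {H G : Graph n} (P : Fin n → Set) →
                 (∀ {x y} → P x → P y → adj H x y ≡ true → adj G x y ≡ true) →
                 ∀ {xs} → All P xs → Chain H xs → Chain G xs
chain-restrict P sub {[]}        _              _       = _
chain-restrict P sub {_ ∷ []}    _              _       = _
chain-restrict P sub {_ ∷ _ ∷ _} (px ∷ py ∷ ps) (e , c) = sub px py e , chain-restrict P sub (py ∷ ps) c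

CycleAt : ∀ {n} → Graph n → Fin n → List (Fin n) → Set
CycleAt G x vs = 2 ≤ length vs × Unique (x ∷ vs) × Chain G (x ∷ vs ++ [ x ])

acyclic-embedding : ∀ {m n} {H : Graph m} {G : Graph n} (f : Fin m → Fin n) →
                    (∀ {x y} → f x ≡ f y → x ≡ y) →
                    (∀ {x y} → adj H x y ≡ true → adj G (f x) (f y) ≡ true) →
                    Acyclic G → Acyclic H
acyclic-embedding {G = G} f inj hom acyclic (x , vs , long , unique , closed) =
  acyclic (f x , List.map f vs ,
           subst (2 ≤_) (sym (length-map f vs)) long ,
           Unique.map⁺ inj unique ,
           subst (Chain G) (cong (f x ∷_) (map-++ f vs [ x ])) (chain-map f hom (x ∷ vs ++ [ x ]) closed))

cycle-rotate : ∀ {n} {G : Graph n} {x vs a} → CycleAt G x vs → a ∈ vs → ∃ (CycleAt G a)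
cycle-rotate {n} {G} {x} {a = a} (long , unique , closed) a∈vs with ∈-∃++ a∈vs
... | A , B , refl = B ++ x ∷ A , long′ , Unique-resp-↭ swap unique , closed′
  where
  open import Data.List.Relation.Binary.Permutation.Setoid.Properties (setoid (Fin n))
    using (++-comm; Unique-resp-↭; xs↭ys⇒|xs|≡|ys|)
  open import Data.List.Relation.Binary.Permutation.Setoid (setoid (Fin n)) using (_↭_)
  swap : (x ∷ A) ++ (a ∷ B) ↭ (a ∷ B) ++ (x ∷ A)
  swap = ++-comm (x ∷ A) (a ∷ B)
  long′ : 2 ≤ length (B ++ x ∷ A)
  long′ = subst (2 ≤_) (suc-injective (xs↭ys⇒|xs|≡|ys| swap)) long
  halves : Chain G (x ∷ A ++ [ a ]) × Chain G (a ∷ B ++ [ x ])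
  halves = chain-split (x ∷ A) a (B ++ [ x ]) (subst (λ t → Chain G (x ∷ t)) (++-assoc A (a ∷ B) [ x ]) closed)
  closed′ : Chain G (a ∷ (B ++ x ∷ A) ++ [ a ])
  closed′ = subst (λ t → Chain G (a ∷ t)) (sym (++-assoc B (x ∷ A) [ a ]))
                  (chain-join (a ∷ B) x (A ++ [ a ]) (proj₂ halves) (proj₁ halves))

Unique-lookup-injective : ∀ {A : Set} {xs : List A} → Unique xs → ∀ i j → List.lookup xs i ≡ List.lookup xs j → i ≡ j
Unique-lookup-injective (_  ∷ _) zero    zero    _ = refl
Unique-lookup-injective (x∉ ∷ _) zero    (suc j) e = ⊥-elim (All.lookup x∉ (∈-lookup j) e)
Unique-lookup-injective (x∉ ∷ _) (suc i) zero    e = ⊥-elim (All.lookup x∉ (∈-lookup i) (sym e))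
Unique-lookup-injective (_  ∷ u) (suc i) (suc j) e = cong suc (Unique-lookup-injective u i j e)

Unique⇒length≤ : ∀ {n} {xs : List (Fin n)} → Unique xs → length xs ≤ n
Unique⇒length≤ {n} {xs} unique with length xs ≤? n
... | yes ≤n = ≤n
... | no  ≰n with pigeonhole (≰⇒> ≰n) (List.lookup xs)
...   | i , j , i<j , same = ⊥-elim (<⇒≢ i<j (cong toℕ (Unique-lookup-injective unique i j same)))

Unique-++⁻ˡ : ∀ {A : Set} xs {ys : List A} → Unique (xs ++ ys) → Unique xs
Unique-++⁻ˡ []       _        = []
Unique-++⁻ˡ (x ∷ xs) (x∉ ∷ u) = ++⁻ˡ xs x∉ ∷ Unique-++⁻ˡ xs u

back-edge-cycle : ∀ {n} {G : Graph n} {h p z} rest → Unique (h ∷ p ∷ rest) → Chain G (h ∷ p ∷ rest) →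
                  adj G h z ≡ true → z ∈ rest → HasCycle G
back-edge-cycle {G = G} {h} {p} {z} rest unique path hz z∈rest with ∈-∃++ z∈rest
... | A , B , refl = h , p ∷ A ++ [ z ] , long , unique′ , closed
  where
  long : 2 ≤ length (p ∷ A ++ [ z ])
  long = s≤s (subst (1 ≤_) (sym (length-++ A)) (m≤n+m 1 (length A)))
  unique′ : Unique (h ∷ p ∷ A ++ [ z ])
  unique′ = Unique-++⁻ˡ (h ∷ p ∷ A ++ [ z ]) (subst (λ t → Unique (h ∷ p ∷ t)) (sym (++-assoc A [ z ] B)) unique)
  closed : Chain G (h ∷ (p ∷ A ++ [ z ]) ++ [ h ])
  closed = subst (λ t → Chain G (h ∷ p ∷ t)) (sym (++-assoc A [ z ] [ h ]))
             (chain-join (h ∷ p ∷ A) z [ h ] (proj₁ (chain-split (h ∷ p ∷ A) z B path)) (adj-sym G hz , _))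

module LeafSearch {n} (G : Graph n) (noIsolated : NoIsolated G) (acyclic : Acyclic G) (x : Fin n) where

  open import Data.List.Membership.DecPropositional (_≟_ {n}) using (_∈?_)

  ReachableLeaf : Set
  ReachableLeaf = Σ (Fin n) λ ℓ → Σ (Fin n) λ p → IsLeaf G ℓ p × Walk G x ℓ

  stuck-at : ∀ h rest → Unique (h ∷ rest) → Chain G (h ∷ rest) → Walk G x h →
             (∀ z → adj G h z ≡ true → z ∈ h ∷ rest) → ReachableLeaf
  stuck-at h [] _ _ _ on-path with neighbour G h (noIsolated h)
  ... | z , hz with on-path z hz
  ...   | here z≡h = ⊥-elim (adj⇒≢ G hz (sym z≡h))
  stuck-at h (p ∷ rest) unique path walk on-path with any? (λ z → (adj G h z Bool.≟ true) ×-dec ¬? (z ≟ p))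
  ... | no  only-p = h , p , (proj₁ path , only-p′) , walk
    where
    only-p′ : ∀ y → adj G h y ≡ true → y ≡ p
    only-p′ y hy = decidable-stable (y ≟ p) (λ y≢p → only-p (y , hy , y≢p))
  ... | yes (z , hz , z≢p) with on-path z hz
  ...   | here z≡h              = ⊥-elim (adj⇒≢ G hz (sym z≡h))
  ...   | there (here z≡p)      = ⊥-elim (z≢p z≡p)
  ...   | there (there z∈rest)  = ⊥-elim (acyclic (back-edge-cycle rest unique path hz z∈rest))

  -- h ∷ rest is a path from x to h, listed backwards; as its vertices are distinct,
  -- n steps of fuel suffice.
  grow : ∀ fuel h rest → Unique (h ∷ rest) → Chain G (h ∷ rest) → Walk G x h →
         n < fuel + length (h ∷ rest) → ReachableLeaf
  grow zero h rest unique _ _ bound = ⊥-elim (<⇒≱ bound (Unique⇒length≤ unique))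
  grow (suc fuel) h rest unique path walk bound
    with any? (λ z → (adj G h z Bool.≟ true) ×-dec ¬? (z ∈? h ∷ rest))
  ... | yes (z , hz , z∉) =
        grow fuel z (h ∷ rest) (¬Any⇒All¬ (h ∷ rest) z∉ ∷ unique) (adj-sym G hz , path) (walk-snoc walk hz)
             (subst (n <_) (sym (+-suc fuel _)) bound)
  ... | no  none = stuck-at h rest unique path walk on-path
    where
    on-path : ∀ z → adj G h z ≡ true → z ∈ h ∷ rest
    on-path z hz = decidable-stable (z ∈? h ∷ rest) (λ z∉ → none (z , hz , z∉))

  reachable-leaf : ReachableLeaf
  reachable-leaf = grow n x [] ([] ∷ []) _ here (subst (n <_) (+-comm 1 n) ≤-refl)

-- Deleting a vertex, adding an edge

removeVertex : ∀ {m} → Graph (suc m) → Fin (suc m) → Graph m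
removeVertex G b = record
  { adj    = λ i j → adj G (punchIn b i) (punchIn b j)
  ; sym    = λ i j → Graph.sym G (punchIn b i) (punchIn b j)
  ; irrefl = λ i → Graph.irrefl G (punchIn b i)
  }

acyclic-removeVertex : ∀ {m} (G : Graph (suc m)) b → Acyclic G → Acyclic (removeVertex G b)
acyclic-removeVertex G b = acyclic-embedding (punchIn b) (punchIn-injective b _ _) id

deg-removeVertex : ∀ {m} (G : Graph (suc m)) b i →
                   deg G (punchIn b i) ≡ 𝟙 (adj G (punchIn b i) b) + deg (removeVertex G b) i
deg-removeVertex {m} G b i = begin
  deg G (punchIn b i)                                            ≡⟨ deg-sum G _ ⟩
  ∑[ j < suc m ] 𝟙 (adj G x j)                                   ≡⟨ sum-remove {i = b} (λ j → 𝟙 (adj G x j)) ⟩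
  𝟙 (adj G x b) + ∑[ j < m ] 𝟙 (adj G x (punchIn b j))           ≡⟨ cong (𝟙 (adj G x b) +_) (sym (deg-sum (removeVertex G b) i)) ⟩
  𝟙 (adj G x b) + deg (removeVertex G b) i                        ∎
  where
  open ≡-Reasoning
  x : Fin (suc m)
  x = punchIn b i

_∪_ : ∀ {n} → Graph n → Graph n → Graph n
G ∪ H = record
  { adj    = λ i j → adj G i j ∨ adj H i j
  ; sym    = λ i j → cong₂ _∨_ (Graph.sym G i j) (Graph.sym H i j)
  ; irrefl = λ i → cong₂ _∨_ (Graph.irrefl G i) (Graph.irrefl H i)
  }

∪-cases : ∀ {n} (G H : Graph n) {x y} → adj (G ∪ H) x y ≡ true → adj G x y ≡ true ⊎ adj H x y ≡ true
∪-cases G H {x} {y} e with adj G x y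
... | true  = inj₁ refl
... | false = inj₂ e

deg-∪ : ∀ {n} (G H : Graph n) x → (∀ j → adj G x j ≡ true → adj H x j ≡ false) →
        deg (G ∪ H) x ≡ deg G x + deg H x
deg-∪ {n} G H x disjoint = begin
  deg (G ∪ H) x                                          ≡⟨ deg-sum (G ∪ H) x ⟩
  ∑[ j < n ] 𝟙 (adj G x j ∨ adj H x j)                   ≡⟨ sum-cong-≗ (λ j → 𝟙-∨ _ _ (disjoint j)) ⟩
  ∑[ j < n ] (𝟙 (adj G x j) + 𝟙 (adj H x j))             ≡⟨ ∑-distrib-+ (λ j → 𝟙 (adj G x j)) (λ j → 𝟙 (adj H x j)) ⟩
  ∑[ j < n ] 𝟙 (adj G x j) + ∑[ j < n ] 𝟙 (adj H x j)    ≡⟨ sym (cong₂ _+_ (deg-sum G x) (deg-sum H x)) ⟩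
  deg G x + deg H x                                      ∎
  where open ≡-Reasoning

edge : ∀ {n} (a c : Fin n) → a ≢ c → Graph n
edge a c a≢c = record
  { adj    = λ i j → (i ≡ᵇ a ∧ j ≡ᵇ c) ∨ (i ≡ᵇ c ∧ j ≡ᵇ a)
  ; sym    = λ i j → trans (cong₂ _∨_ (∧-comm (i ≡ᵇ a) (j ≡ᵇ c)) (∧-comm (i ≡ᵇ c) (j ≡ᵇ a)))
                           (∨-comm (j ≡ᵇ c ∧ i ≡ᵇ a) (j ≡ᵇ a ∧ i ≡ᵇ c))
  ; irrefl = loopless
  }
  where
  loopless : ∀ i → ((i ≡ᵇ a ∧ i ≡ᵇ c) ∨ (i ≡ᵇ c ∧ i ≡ᵇ a)) ≡ false
  loopless i with i ≟ a
  ... | yes refl rewrite ≢⇒≡ᵇ-false a≢c = refl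
  ... | no  _    = ∧-zeroʳ (i ≡ᵇ c)

edge-cases : ∀ {n} {a c : Fin n} (a≢c : a ≢ c) {x y} → adj (edge a c a≢c) x y ≡ true →
             (x ≡ a × y ≡ c) ⊎ (x ≡ c × y ≡ a)
edge-cases {a = a} {c} _ {x} {y} e with x ≟ a | y ≟ c | x ≟ c | y ≟ a
... | yes x≡a | yes y≡c | _       | _       = inj₁ (x≡a , y≡c)
... | _       | _       | yes x≡c | yes y≡a = inj₂ (x≡c , y≡a)
... | no _    | _       | no _    | _       with () ← e
... | no _    | _       | yes _   | no _    with () ← e
... | yes _   | no _    | no _    | _       with () ← e
... | yes _   | no _    | yes _   | no _    with () ← e

deg-edge : ∀ {n} {a c : Fin n} (a≢c : a ≢ c) x → deg (edge a c a≢c) x ≡ 𝟙 (x ≡ᵇ a) + 𝟙 (x ≡ᵇ c)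
deg-edge {n} {a} {c} a≢c x = begin
  deg (edge a c a≢c) x                                               ≡⟨ deg-sum (edge a c a≢c) x ⟩
  ∑[ j < n ] 𝟙 ((x ≡ᵇ a ∧ j ≡ᵇ c) ∨ (x ≡ᵇ c ∧ j ≡ᵇ a))                ≡⟨ sum-cong-≗ (λ j → 𝟙-∨ _ _ (disjoint j)) ⟩
  ∑[ j < n ] (𝟙 (x ≡ᵇ a ∧ j ≡ᵇ c) + 𝟙 (x ≡ᵇ c ∧ j ≡ᵇ a))             ≡⟨ ∑-distrib-+ (λ j → 𝟙 (x ≡ᵇ a ∧ j ≡ᵇ c)) (λ j → 𝟙 (x ≡ᵇ c ∧ j ≡ᵇ a)) ⟩
  ∑[ j < n ] 𝟙 (x ≡ᵇ a ∧ j ≡ᵇ c) + ∑[ j < n ] 𝟙 (x ≡ᵇ c ∧ j ≡ᵇ a)    ≡⟨ cong₂ _+_ (sum-𝟙-∧-≡ᵇ (x ≡ᵇ a) c) (sum-𝟙-∧-≡ᵇ (x ≡ᵇ c) a) ⟩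
  𝟙 (x ≡ᵇ a) + 𝟙 (x ≡ᵇ c)                                            ∎
  where
  open ≡-Reasoning
  disjoint : ∀ j → (x ≡ᵇ a ∧ j ≡ᵇ c) ≡ true → (x ≡ᵇ c ∧ j ≡ᵇ a) ≡ false
  disjoint j e with x ≟ a
  ... | yes refl rewrite ≢⇒≡ᵇ-false a≢c = refl

-- Components

EdgeRespecting : ∀ {n} → Graph n → (Fin n → Bool) → Set
EdgeRespecting G S = ∀ {i j} → adj G i j ≡ true → S i ≡ S j

walk-respects : ∀ {n} {G : Graph n} {S} → EdgeRespecting G S → ∀ {x y} → Walk G x y → S x ≡ S y
walk-respects respects here       = refl
walk-respects respects (step e p) = trans (respects e) (walk-respects respects p)

module Reachability {n} (G : Graph n) (u : Fin n) where

  Reached : (Fin n → Bool) → Set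
  Reached R = ∀ x → R x ≡ true → Walk G u x

  Closed : (Fin n → Bool) → Set
  Closed R = ∀ {i j} → adj G i j ≡ true → R i ≡ true → R j ≡ true

  size : (Fin n → Bool) → ℕ
  size R = ∑[ j < n ] 𝟙 (R j)

  -- Every round adds a vertex to R, so n rounds suffice.
  explore : ∀ fuel R → Reached R → n < fuel + size R →
            Σ (Fin n → Bool) λ S → Reached S × Closed S × (∀ x → R x ≡ true → S x ≡ true)
  explore zero R _ bound = ⊥-elim (<⇒≱ bound (sum-𝟙≤ R))
  explore (suc fuel) R reached bound
    with any? (λ i → any? (λ j → (adj G i j Bool.≟ true) ×-dec (R i Bool.≟ true) ×-dec (R j Bool.≟ false)))
  ... | no none = R , reached , closed , λ _ → id
    where
    closed : Closed R
    closed {i} {j} ij Ri with R j in Rj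
    ... | true  = refl
    ... | false = ⊥-elim (none (i , j , ij , Ri , Rj))
  ... | yes (i , j , ij , Ri , Rj) =
    let S , reachedS , closedS , R′⊆S = explore fuel R′ reached′ bound′
    in  S , reachedS , closedS , λ x Rx → R′⊆S x (R⊆R′ x Rx)
    where
    R′ : Fin n → Bool
    R′ y = R y ∨ y ≡ᵇ j
    R⊆R′ : ∀ x → R x ≡ true → R′ x ≡ true
    R⊆R′ x Rx rewrite Rx = refl
    reached′ : Reached R′
    reached′ y R′y with R y in Ry
    ... | true  = reached y Ry
    ... | false with ≡ᵇ⇒≡ {i = y} {j} R′y
    ...   | refl = walk-snoc (reached i Ri) ij
    grows : size R < size R′
    grows = sum-mono-< (λ y → 𝟙-∨-≤ (R y) (y ≡ᵇ j)) j j-added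
      where
      j-added : 𝟙 (R j) < 𝟙 (R′ j)
      j-added rewrite Rj | ≡ᵇ-refl j = ≤-refl
    bound′ : n < fuel + size R′
    bound′ = <-≤-trans bound (subst (_≤ fuel + size R′) (+-suc fuel (size R)) (+-monoʳ-≤ fuel grows))

  component : Σ (Fin n → Bool) λ S → EdgeRespecting G S × S u ≡ true × Reached S
  component =
    let S , reached , closed , u∈S = explore n (_≡ᵇ u) from-u bound
    in  S , respecting closed , u∈S u (≡ᵇ-refl u) , reached
    where
    from-u : Reached (_≡ᵇ u)
    from-u x x≡ᵇu with ≡ᵇ⇒≡ {i = x} {u} x≡ᵇu
    ... | refl = here
    bound : n < n + size (_≡ᵇ u)
    bound = subst (λ k → n < n + k) (sym (sum-𝟙-∧-≡ᵇ true u)) (m<m+n n (s≤s z≤n))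
    respecting : ∀ {S} → Closed S → EdgeRespecting G S
    respecting {S} closed {i} {j} ij with S i in Si | S j in Sj
    ... | true  | true  = refl
    ... | false | false = refl
    ... | true  | false = trans (sym (closed ij Si)) Sj
    ... | false | true  = trans (sym Si) (closed (adj-sym G ij) Sj)

  walk-or-separated : ∀ v → Walk G u v ⊎ ∃ λ S → EdgeRespecting G S × S u ≢ S v
  walk-or-separated v with component
  ... | S , respects , Su , reached with S v in Sv
  ...   | true  = inj₁ (reached v Sv)
  ...   | false = inj₂ (S , respects , λ Su≡Sv → case trans (sym Su) (trans Su≡Sv Sv) of λ ())

module AcrossComponents {n} {G : Graph n} (acyclic : Acyclic G) {S : Fin n → Bool} (respects : EdgeRespecting G S)
                        {a c : Fin n} (separated : S a ≢ S c) where

  open import Data.List.Membership.DecPropositional (_≟_ {n}) using (_∈?_)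

  a≢c : a ≢ c
  a≢c = separated ∘ cong S

  private
    E : Graph n
    E = G ∪ edge a c a≢c

    edge-off-a : ∀ {x y} → a ≢ x → a ≢ y → adj E x y ≡ true → adj G x y ≡ true
    edge-off-a {x} {y} a≢x a≢y e with ∪-cases G (edge a c a≢c) e
    ... | inj₁ g = g
    ... | inj₂ new with edge-cases a≢c {x} {y} new
    ...   | inj₁ (refl , _) = ⊥-elim (a≢x refl)
    ...   | inj₂ (_ , refl) = ⊥-elim (a≢y refl)

    edge-at-a : ∀ {y} → adj E a y ≡ true → y ≡ c ⊎ adj G a y ≡ true
    edge-at-a {y} e with ∪-cases G (edge a c a≢c) e
    ... | inj₁ g = inj₂ g
    ... | inj₂ new with edge-cases a≢c {a} {y} new
    ...   | inj₁ (_ , y≡c)  = inj₁ y≡c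
    ...   | inj₂ (a≡c , _) = ⊥-elim (a≢c a≡c)

    -- v₁ … vₖ avoids a, so it is a path of G and S v₁ ≡ S vₖ; at most one of v₁, vₖ is c.
    no-cycle-through-a : ∀ v₁ M vₖ → ¬ CycleAt E a (v₁ ∷ M ++ [ vₖ ])
    no-cycle-through-a v₁ M vₖ (long , unique@(a∉ ∷ v₁∉ ∷ _) , (av₁ , closed)) =
      case edge-at-a av₁ , edge-at-a (adj-sym E vₖa) of λ where
        (inj₁ refl , inj₁ refl) → v₁≢vₖ refl
        (inj₁ refl , inj₂ avₖ)  → separated (trans (respects avₖ) (sym Sv₁≡Svₖ))
        (inj₂ av₁  , inj₁ refl) → separated (trans (respects av₁) Sv₁≡Svₖ)
        (inj₂ av₁  , inj₂ avₖ)  → acyclic (a , v₁ ∷ M ++ [ vₖ ] , long , unique ,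
                                   av₁ , subst (λ t → Chain G (v₁ ∷ t)) (sym (++-assoc M [ vₖ ] [ a ]))
                                           (chain-join (v₁ ∷ M) vₖ [ a ] innerG (adj-sym G avₖ , _)))
      where
      halves : Chain E (v₁ ∷ M ++ [ vₖ ]) × Chain E (vₖ ∷ [ a ])
      halves = chain-split (v₁ ∷ M) vₖ [ a ] (subst (λ t → Chain E (v₁ ∷ t)) (++-assoc M [ vₖ ] [ a ]) closed)
      vₖa : adj E vₖ a ≡ true
      vₖa = proj₁ (proj₂ halves)
      innerG : Chain G (v₁ ∷ M ++ [ vₖ ])
      innerG = chain-restrict (a ≢_) (λ a≢x a≢y → edge-off-a a≢x a≢y) a∉ (proj₁ halves)
      Sv₁≡Svₖ : S v₁ ≡ S vₖ
      Sv₁≡Svₖ = walk-respects respects (chain⇒walk v₁ M vₖ innerG)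
      v₁≢vₖ : v₁ ≢ vₖ
      v₁≢vₖ = All.head (++⁻ʳ M v₁∉)

    no-cycle-at-a : ∀ vs → ¬ CycleAt E a vs
    no-cycle-at-a vs cycle with initLast vs
    no-cycle-at-a _ (()      , _) | []
    no-cycle-at-a _ (s≤s () , _) | [] ∷ʳ′ _
    no-cycle-at-a _ cycle        | (v₁ ∷ M) ∷ʳ′ vₖ = no-cycle-through-a v₁ M vₖ cycle

  acyclic-∪-edge : Acyclic (G ∪ edge a c a≢c)
  acyclic-∪-edge (x , vs , cycle@(long , unique , closed)) with a ∈? (x ∷ vs)
  ... | yes (here refl) = no-cycle-at-a vs cycle
  ... | yes (there a∈vs) = let vs′ , cycle′ = cycle-rotate cycle a∈vs in no-cycle-at-a vs′ cycle′
  ... | no a∉ = acyclic (x , vs , long , unique ,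
                         chain-restrict (a ≢_) (λ a≢x a≢y → edge-off-a a≢x a≢y) (++⁺ avoids (All.head avoids ∷ [])) closed)
    where
    avoids : All (a ≢_) (x ∷ vs)
    avoids = ¬Any⇒All¬ (x ∷ vs) a∉

-- Moving a leaf to another component

module LeafTransfer {m} (F : Graph (suc m)) (acyclic : Acyclic F) {S} (respects : EdgeRespecting F S)
                    {a b c : Fin (suc m)} (deg-a : deg F a ≡ 1) (b-leaf : IsLeaf F b c) (separated : S a ≢ S c) where

  open AcrossComponents acyclic respects separated

  E : Graph (suc m)
  E = F ∪ edge a c a≢c

  F′ : Graph m
  F′ = removeVertex E b

  private
    σ : Fin m → Fin (suc m)
    σ = punchIn b

    deg-b : deg F b ≡ 1
    deg-b = deg-leaf F b-leaf

    a≢b : a ≢ b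
    a≢b a≡b = separated (trans (cong S a≡b) (respects (proj₁ b-leaf)))

    b≢c : b ≢ c
    b≢c = adj⇒≢ F (proj₁ b-leaf)

    ac-absent : adj F a c ≡ false
    ac-absent with adj F a c in ac
    ... | true  = ⊥-elim (separated (respects ac))
    ... | false = refl

    no-double-edge : ∀ x j → adj F x j ≡ true → adj (edge a c a≢c) x j ≡ false
    no-double-edge x j xj with adj (edge a c a≢c) x j in new
    ... | false = refl
    ... | true with edge-cases a≢c {x} {j} new
    ...   | inj₁ (refl , refl) = trans (sym xj) ac-absent
    ...   | inj₂ (refl , refl) = trans (sym xj) (trans (Graph.sym F c a) ac-absent)

    edge-avoids-b : ∀ x → adj (edge a c a≢c) x b ≡ false
    edge-avoids-b x with adj (edge a c a≢c) x b in new
    ... | false = refl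
    ... | true with edge-cases a≢c {x} {b} new
    ...   | inj₁ (_ , b≡c) = ⊥-elim (b≢c b≡c)
    ...   | inj₂ (_ , b≡a) = ⊥-elim (a≢b (sym b≡a))

    adj-E-b : ∀ x → adj E x b ≡ x ≡ᵇ c
    adj-E-b x = trans (cong₂ _∨_ (leaf-adj F b-leaf x) (edge-avoids-b x)) (∨-identityʳ _)

  -- Deleting b takes from c exactly the degree that the new edge gives it.
  deg-F′ : ∀ i → deg F′ i ≡ deg F (σ i) + 𝟙 (σ i ≡ᵇ a)
  deg-F′ i = +-cancelʳ-≡ (𝟙 (x ≡ᵇ c)) _ _ (begin
    deg F′ i + 𝟙 (x ≡ᵇ c)                  ≡⟨ +-comm (deg F′ i) _ ⟩
    𝟙 (x ≡ᵇ c) + deg F′ i                  ≡⟨ cong (λ t → 𝟙 t + deg F′ i) (sym (adj-E-b x)) ⟩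
    𝟙 (adj E x b) + deg F′ i               ≡⟨ sym (deg-removeVertex E b i) ⟩
    deg E x                                ≡⟨ deg-∪ F (edge a c a≢c) x (no-double-edge x) ⟩
    deg F x + deg (edge a c a≢c) x         ≡⟨ cong (deg F x +_) (deg-edge a≢c x) ⟩
    deg F x + (𝟙 (x ≡ᵇ a) + 𝟙 (x ≡ᵇ c))    ≡⟨ sym (+-assoc (deg F x) _ _) ⟩
    deg F x + 𝟙 (x ≡ᵇ a) + 𝟙 (x ≡ᵇ c)      ∎)
    where
    open ≡-Reasoning
    x : Fin (suc m)
    x = σ i

  private
    b≢a : b ≢ a
    b≢a = a≢b ∘ sym

    a′ : Fin m
    a′ = punchOut b≢a

    deg-F′-at-a : ∀ {i} → σ i ≡ a → deg F′ i ≡ 2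
    deg-F′-at-a {i} σi≡a = trans (deg-F′ i)
      (subst (λ v → deg F v + 𝟙 (v ≡ᵇ a) ≡ 2) (sym σi≡a) (cong₂ _+_ deg-a (cong 𝟙 (≡ᵇ-refl a))))

    deg-F′-off-a : ∀ {i} → σ i ≢ a → deg F′ i ≡ deg F (σ i)
    deg-F′-off-a {i} σi≢a = trans (deg-F′ i)
      (trans (cong (λ t → deg F (σ i) + 𝟙 t) (≢⇒≡ᵇ-false σi≢a)) (+-identityʳ (deg F (σ i))))

    a-counted-once : ∑[ i < m ] 𝟙 (σ i ≡ᵇ a) ≡ 1
    a-counted-once = begin
      ∑[ i < m ] 𝟙 (σ i ≡ᵇ a)                    ≡⟨ cong (λ t → 𝟙 t + ∑[ i < m ] 𝟙 (σ i ≡ᵇ a)) (sym (≢⇒≡ᵇ-false b≢a)) ⟩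
      𝟙 (b ≡ᵇ a) + ∑[ i < m ] 𝟙 (σ i ≡ᵇ a)       ≡⟨ sym (sum-remove {i = b} (λ j → 𝟙 (j ≡ᵇ a))) ⟩
      ∑[ j < suc m ] 𝟙 (j ≡ᵇ a)                  ≡⟨ sum-𝟙-∧-≡ᵇ true a ⟩
      1                                          ∎
      where open ≡-Reasoning

  acyclic-F′ : Acyclic F′
  acyclic-F′ = acyclic-removeVertex E b acyclic-∪-edge

  numEdges-F′ : numEdges F′ ≡ numEdges F
  numEdges-F′ = *-cancelˡ-≡ _ _ 2 (begin
    2 * numEdges F′                                         ≡⟨ sym (handshake F′) ⟩
    ∑[ i < m ] deg F′ i                                     ≡⟨ sum-cong-≗ deg-F′ ⟩
    ∑[ i < m ] (deg F (σ i) + 𝟙 (σ i ≡ᵇ a))                 ≡⟨ ∑-distrib-+ (λ i → deg F (σ i)) (λ i → 𝟙 (σ i ≡ᵇ a)) ⟩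
    ∑[ i < m ] deg F (σ i) + ∑[ i < m ] 𝟙 (σ i ≡ᵇ a)        ≡⟨ cong (∑[ i < m ] deg F (σ i) +_) a-counted-once ⟩
    ∑[ i < m ] deg F (σ i) + 1                              ≡⟨ +-comm _ 1 ⟩
    1 + ∑[ i < m ] deg F (σ i)                              ≡⟨ cong (_+ ∑[ i < m ] deg F (σ i)) (sym deg-b) ⟩
    deg F b + ∑[ i < m ] deg F (σ i)                        ≡⟨ sym (sum-remove {i = b} (deg F)) ⟩
    ∑[ v < suc m ] deg F v                                  ≡⟨ handshake F ⟩
    2 * numEdges F                                          ∎)
    where open ≡-Reasoning

  noIsolated-F′ : NoIsolated F → NoIsolated F′
  noIsolated-F′ noIsolated i = ≤-trans (noIsolated (σ i)) (≤-trans (m≤m+n _ _) (≤-reflexive (sym (deg-F′ i))))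

  maxDegree-F′ : ∀ {D} → 2 ≤ D → MaxDegree F D → MaxDegree F′ D
  maxDegree-F′ {D} 2≤D (≤D , w , deg-w) = bounded , punchOut b≢w , attained
    where
    bounded : ∀ i → deg F′ i ≤ D
    bounded i = case σ i ≟ a of λ where
      (yes σi≡a) → ≤-trans (≤-reflexive (deg-F′-at-a σi≡a)) 2≤D
      (no  σi≢a) → ≤-trans (≤-reflexive (deg-F′-off-a σi≢a)) (≤D (σ i))
    not-leaf : ∀ {v} → deg F v ≡ 1 → w ≢ v
    not-leaf deg-v refl = <⇒≢ 2≤D (sym (trans (sym deg-w) deg-v))
    b≢w : b ≢ w
    b≢w b≡w = not-leaf deg-b (sym b≡w)
    attained : deg F′ (punchOut b≢w) ≡ D
    attained = trans (deg-F′-off-a (λ σw′≡a → not-leaf deg-a (trans (sym (punchIn-punchOut b≢w)) σw′≡a)))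
                     (trans (cong (deg F) (punchIn-punchOut b≢w)) deg-w)

  lineEdges-F′ : lineEdges F < lineEdges F′
  lineEdges-F′ = subst₂ _<_ (sym lineEdges-F) (sym (lineEdges-sum F′)) (sum-mono-< pointwise a′ at-a)
    where
    lineEdges-F : lineEdges F ≡ ∑[ i < m ] (deg F (σ i) C 2)
    lineEdges-F rewrite lineEdges-sum F | sum-remove {i = b} (λ v → deg F v C 2) | deg-b = refl
    pointwise : ∀ i → deg F (σ i) C 2 ≤ deg F′ i C 2
    pointwise i = case σ i ≟ a of λ where
      (yes σi≡a) → subst (λ d → d C 2 ≤ deg F′ i C 2) (sym (trans (cong (deg F) σi≡a) deg-a)) z≤n
      (no  σi≢a) → ≤-reflexive (cong (_C 2) (sym (deg-F′-off-a σi≢a)))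
    at-a : deg F (σ a′) C 2 < deg F′ a′ C 2
    at-a = subst₂ (λ d d′ → d C 2 < d′ C 2)
                  (sym (trans (cong (deg F) (punchIn-punchOut b≢a)) deg-a)) (sym (deg-F′-at-a (punchIn-punchOut b≢a)))
                  ≤-refl

improve-disconnected : ∀ {N D m} (F : Graph (suc m)) → 2 ≤ D → Admissible N D F →
                       ∀ {S} → EdgeRespecting F S → ∀ {u v} → S u ≢ S v →
                       Σ (Graph m) λ F′ → Admissible N D F′ × lineEdges F < lineEdges F′
improve-disconnected F 2≤D (acyclic , edges , maxDegree , noIsolated) {S} respects {u} {v} Su≢Sv
  with LeafSearch.reachable-leaf F noIsolated acyclic u | LeafSearch.reachable-leaf F noIsolated acyclic v
... | a , _ , a-leaf , u⇝a | b , c , b-leaf , v⇝b =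
  F′ , (acyclic-F′ , trans numEdges-F′ edges , maxDegree-F′ 2≤D maxDegree , noIsolated-F′ noIsolated) , lineEdges-F′
  where
  separated : S a ≢ S c
  separated Sa≡Sc = Su≢Sv (begin
    S u ≡⟨ walk-respects respects u⇝a ⟩
    S a ≡⟨ Sa≡Sc ⟩
    S c ≡⟨ respects (adj-sym F (proj₁ b-leaf)) ⟩
    S b ≡⟨ walk-respects respects v⇝b ⟨
    S v ∎)
    where open ≡-Reasoning
  open LeafTransfer F acyclic respects (deg-leaf F a-leaf) b-leaf separated

optimal⇒connected : ∀ {N D m} (F : Graph (suc m)) → 2 ≤ D → Admissible N D F → AttainsG N D F → Connected F
optimal⇒connected {m = m} F 2≤D admissible optimal u v with Reachability.walk-or-separated F u v
... | inj₁ walk = walk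
... | inj₂ (_ , respects , separated) =
  let F′ , admissible′ , better = improve-disconnected F 2≤D admissible respects separated
  in  ⊥-elim (<⇒≱ better (optimal m F′ admissible′))

mainTheorem6 : (N D : ℕ) → 2 ≤ D → D ≤ N →
    ∀ n (F : Graph n) → Admissible N D F → AttainsG N D F → IsTree F
-- The hypothesis D ≤ N only makes the family defining g(N, D) nonempty.
mainTheorem6 N D 2≤D _ zero    F (_ , _ , (_ , () , _) , _) _
mainTheorem6 N D 2≤D _ (suc m) F admissible optimal =
  s≤s z≤n , optimal⇒connected F 2≤D admissible optimal , proj₁ admissible
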